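{- Let $G$ be a threshold graph with vertex set $V$, and let $V=K\cup (V\setminus K)$ be a partition such that $G[K]$ is a clique and $G[V\setminus K]$ is an independent set, with $|K|=s$. Let $B$ be the bipartite graph with parts $K$ and $V\setminus K$ whose edge set is the set of edges of $G$ between $K$ and $V\setminus K$. Then $$m(G)=\sum_{k\ge 0} m_k(B)\, m(K_{s-k}).$$
   Context: A matching is a set of pairwise non-incident edges (the empty set counts). $m(H)$ is the number of matchings of $H$ and $m_k(H)$ the number of matchings with exactly $k$ edges; $K_j$ is the complete graph on $j$ vertices (with $m(K_j)=0$ for $j<0$ irrelevant since $m_k(B)=0$ for $k>s$). A threshold graph is a simple graph $G$ for which there exist $w:V(G)\to\mathbb{R}$ and $t\in\mathbb{R}$ such that for distinct $x,y$, $xy\in E(G)$ iff $w(x)+w(y)\ge t$.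
   Formalization: The threshold weights $w$ and $t$ take rational values rather than real ones. -}

module Defs where

open import Data.Bool using (Bool; true; false; _∧_; _xor_; not; if_then_else_)
open import Data.Nat using (ℕ; zero; suc; _+_; _*_; _∸_)
open import Data.Fin using (Fin; _<?_; _≟_)
open import Data.List using (List; []; _∷_; map; filter; length; concatMap; allFin; upTo; _++_)
open import Data.Nat.ListAction using (sum)
open import Data.Product using (_×_; _,_)
open import Relation.Nullary.Decidable using (does; ⌊_⌋)
open import Relation.Binary.PropositionalEquality using (_≡_)

-- A (simple) graph on the vertex set Fin n, given by a Boolean adjacency
-- function.  Simplicity (symmetry, irreflexivity) is imposed as hypotheses
-- where needed.
Adj : ℕ → Set
Adj n = Fin n → Fin n → Bool

IsSimple : ∀ {n} → Adj n → Set
IsSimple {n} G = (∀ (x y : Fin n) → G x y ≡ G y x) × (∀ (x : Fin n) → G x x ≡ false)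

edges : ∀ {n} → Adj n → List (Fin n × Fin n)
edges {n} G = concatMap (λ i → concatMap (λ j →
                 if does (i <? j) ∧ G i j then (i , j) ∷ [] else []) (allFin n)) (allFin n)

-- all sub-lists (= subsets, since the edge list has no duplicates)
subsets : ∀ {A : Set} → List A → List (List A)
subsets []       = [] ∷ []
subsets (x ∷ xs) = subsets xs ++ map (x ∷_) (subsets xs)

disjointEdge : ∀ {n} → Fin n × Fin n → Fin n × Fin n → Bool
disjointEdge (a , b) (c , d) =
  not (does (a ≟ c)) ∧ not (does (a ≟ d)) ∧ not (does (b ≟ c)) ∧ not (does (b ≟ d))

allL : ∀ {A : Set} → (A → Bool) → List A → Bool
allL p []       = true
allL p (x ∷ xs) = p x ∧ allL p xs

isMatching : ∀ {n} → List (Fin n × Fin n) → Bool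
isMatching []       = true
isMatching (e ∷ es) = allL (disjointEdge e) es ∧ isMatching es

matchings : ∀ {n} → Adj n → List (List (Fin n × Fin n))
matchings G = filter (λ M → isMatching M ≟b true) (subsets (edges G))
  where
  open import Data.Bool.Properties using () renaming (_≟_ to _≟b_)

m : ∀ {n} → Adj n → ℕ
m G = length (matchings G)

mk : ∀ {n} → ℕ → Adj n → ℕ
mk k G = length (filter (λ M → length M Data.Nat.≟ k) (matchings G))

complete : (j : ℕ) → Adj j
complete j x y = not (does (x ≟ y))

open import Data.Rational using (ℚ) renaming (_+_ to _+ℚ_; _≤_ to _≤ℚ_)
open import Relation.Nullary using (¬_)
open import Function.Bundles using (_⇔_)
open import Data.Product using (Σ)

IsThreshold : ∀ {n} → Adj n → Set
IsThreshold {n} G = Σ (Fin n → ℚ) λ w → Σ ℚ λ t →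
  ∀ (x y : Fin n) → ¬ (x ≡ y) → ((G x y ≡ true) ⇔ (t ≤ℚ w x +ℚ w y))

card : ∀ {n} → (Fin n → Bool) → ℕ
card {n} K = length (filter (λ x → K x Data.Bool.Properties.≟ true) (allFin n))
  where import Data.Bool.Properties

IsClique : ∀ {n} → Adj n → (Fin n → Bool) → Set
IsClique {n} G K = ∀ (x y : Fin n) → K x ≡ true → K y ≡ true → ¬ (x ≡ y) → G x y ≡ true

IsIndependent : ∀ {n} → Adj n → (Fin n → Bool) → Set
IsIndependent {n} G S = ∀ (x y : Fin n) → S x ≡ true → S y ≡ true → G x y ≡ false

-- bipartite graph B: same vertex set, parts K and V∖K, edges of G between them
between : ∀ {n} → Adj n → (Fin n → Bool) → Adj n
between G K x y = G x y ∧ (K x xor K y)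

sumUpTo : ℕ → (ℕ → ℕ) → ℕ
sumUpTo s f = sum (map f (upTo (suc s)))

-- G has no edges inside V ∖ K, so its edges are those of the clique on K and those of B,
-- each of which has exactly one end in K.  Count matchings by deciding edge after edge
-- whether to use it, keeping track of the set of still uncovered vertices; the count does
-- not depend on the order of the edges, so the edges of B can be decided first.  A k-edge
-- matching M of B leaves exactly s − k vertices of K uncovered, and the matchings of G
-- extending M are then the matchings of the clique on those vertices: m(K_{s−k}) of them.

module Submission where

open import Defs
open import Data.Bool using (Bool; true; false; _∧_; not; _xor_; if_then_else_; T)
open import Data.Bool.Properties
  using (∧-assoc; ∧-comm; ∧-identityʳ; ∧-zeroʳ; ∧-commutativeMonoid) renaming (_≟_ to _≟ᵇ_)
open import Data.Fin using (Fin; zero; suc; _≟_; _<?_)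
open import Data.List
  using (List; []; _∷_; _++_; map; length; filter; filterᵇ; concatMap; allFin; tabulate; upTo)
open import Data.List.Properties
  using (concatMap-cong; concatMap-map; map-concatMap; map-tabulate; map-cong; map-applyUpTo; filter-++)
open import Data.List.Relation.Unary.All using (All; []; _∷_)
open import Data.List.Relation.Unary.All.Properties using (all-filter)
open import Data.Nat using (ℕ; zero; suc; _+_; _*_; _∸_)
import Data.Nat as ℕ
open import Data.Nat.ListAction using (sum)
open import Data.Nat.Properties
  using (+-identityʳ; +-assoc; +-comm; *-identityˡ; *-distribʳ-+; +-commutativeSemigroup)
open import Data.Product using (_×_; _,_)
open import Function using (_∘_; id)
open import Relation.Binary.PropositionalEquality
open import Relation.Nullary using (yes; no; contradiction)
open import Relation.Nullary.Decidable using (does; dec-true; T?)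
open import Relation.Unary using (Pred; Decidable)
open import Algebra.Solver.CommutativeMonoid ∧-commutativeMonoid using (solve; _⊜_; _⊕_)
open import Algebra.Properties.CommutativeSemigroup +-commutativeSemigroup using (interchange)
open ≡-Reasoning

private
  variable
    n : ℕ
    A C : Set

VertexSet : ℕ → Set
VertexSet n = Fin n → Bool

Edge : ℕ → Set
Edge n = Fin n × Fin n

univ : VertexSet n
univ _ = true

_∩_ : VertexSet n → VertexSet n → VertexSet n
(P ∩ Q) v = P v ∧ Q v

_≢ᵇ_ : Fin n → Fin n → Bool
a ≢ᵇ b = not (does (a ≟ b))

free : VertexSet n → Edge n → Bool
free F (a , b) = F a ∧ F b

_∖_ : VertexSet n → Edge n → VertexSet n
(F ∖ (a , b)) v = F v ∧ (a ≢ᵇ v ∧ b ≢ᵇ v)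

≢ᵇ-sym : (a b : Fin n) → a ≢ᵇ b ≡ b ≢ᵇ a
≢ᵇ-sym a b with a ≟ b | b ≟ a
... | yes _   | yes _   = refl
... | no _    | no _    = refl
... | yes a≡b | no b≢a  = contradiction (sym a≡b) b≢a
... | no a≢b  | yes b≡a = contradiction (sym b≡a) a≢b

disjointEdge-sym : (e f : Edge n) → disjointEdge e f ≡ disjointEdge f e
disjointEdge-sym (a , b) (c , d)
  rewrite ≢ᵇ-sym c a | ≢ᵇ-sym c b | ≢ᵇ-sym d a | ≢ᵇ-sym d b =
  solve 4 (λ ac ad bc bd → ac ⊕ ad ⊕ bc ⊕ bd ⊜ ac ⊕ bc ⊕ ad ⊕ bd) refl
    (a ≢ᵇ c) (a ≢ᵇ d) (b ≢ᵇ c) (b ≢ᵇ d)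

disjointEdge-free : (F : VertexSet n) (e f : Edge n) → disjointEdge e f ∧ free F f ≡ free (F ∖ e) f
disjointEdge-free F (a , b) (c , d) =
  solve 6 (λ ac ad bc bd Fc Fd → (ac ⊕ ad ⊕ bc ⊕ bd) ⊕ (Fc ⊕ Fd)
                               ⊜ (Fc ⊕ (ac ⊕ bc)) ⊕ (Fd ⊕ (ad ⊕ bd))) refl
    (a ≢ᵇ c) (a ≢ᵇ d) (b ≢ᵇ c) (b ≢ᵇ d) (F c) (F d)

free-∖-comm : (F : VertexSet n) (e f : Edge n) →
              free F e ∧ free (F ∖ e) f ≡ free F f ∧ free (F ∖ f) e
free-∖-comm F e f = begin
  free F e ∧ free (F ∖ e) f
    ≡⟨ cong (free F e ∧_) (disjointEdge-free F e f) ⟨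
  free F e ∧ (disjointEdge e f ∧ free F f)
    ≡⟨ cong (λ x → free F e ∧ (x ∧ free F f)) (disjointEdge-sym e f) ⟩
  free F e ∧ (disjointEdge f e ∧ free F f)
    ≡⟨ solve 3 (λ x y z → x ⊕ (y ⊕ z) ⊜ z ⊕ (y ⊕ x)) refl
               (free F e) (disjointEdge f e) (free F f) ⟩
  free F f ∧ (disjointEdge f e ∧ free F e)
    ≡⟨ cong (free F f ∧_) (disjointEdge-free F f e) ⟩
  free F f ∧ free (F ∖ f) e ∎

∖-comm : (F : VertexSet n) (e f : Edge n) → (F ∖ e) ∖ f ≗ (F ∖ f) ∖ e
∖-comm F (a , b) (c , d) v =
  solve 5 (λ x av bv cv dv → (x ⊕ (av ⊕ bv)) ⊕ (cv ⊕ dv) ⊜ (x ⊕ (cv ⊕ dv)) ⊕ (av ⊕ bv)) refl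
    (F v) (a ≢ᵇ v) (b ≢ᵇ v) (c ≢ᵇ v) (d ≢ᵇ v)

∖-swap : (F : VertexSet n) (a b : Fin n) → F ∖ (a , b) ≗ F ∖ (b , a)
∖-swap F a b v = cong (F v ∧_) (∧-comm (a ≢ᵇ v) (b ≢ᵇ v))

free-cong : {F G : VertexSet n} → F ≗ G → (e : Edge n) → free F e ≡ free G e
free-cong F≗G (a , b) = cong₂ _∧_ (F≗G a) (F≗G b)

∖-cong : {F G : VertexSet n} → F ≗ G → (e : Edge n) → F ∖ e ≗ G ∖ e
∖-cong F≗G e v = cong (_∧ _) (F≗G v)

private
  ∧-trueˡ : (a : Bool) {b : Bool} → a ∧ b ≡ true → a ≡ true
  ∧-trueˡ true _ = refl

  ∧-trueʳ : (a : Bool) {b : Bool} → a ∧ b ≡ true → b ≡ true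
  ∧-trueʳ true ab = ab

concatMap-allFin-suc : (f : Fin (suc n) → List A) →
                       concatMap f (allFin (suc n)) ≡ f zero ++ concatMap (f ∘ suc) (allFin n)
concatMap-allFin-suc {n} f = cong (f zero ++_)
  (trans (cong (concatMap f) (sym (map-tabulate id suc))) (concatMap-map f suc (allFin n)))

concatMap-singletons : (q : A → Bool) (f : A → C) (xs : List A) →
                       concatMap (λ x → if q x then f x ∷ [] else []) xs ≡ map f (filterᵇ q xs)
concatMap-singletons q f []       = refl
concatMap-singletons q f (x ∷ xs) with q x
... | true  = cong (f x ∷_) (concatMap-singletons q f xs)
... | false = concatMap-singletons q f xs

filterᵇ-concatMap : (p : C → Bool) (f : A → List C) (xs : List A) →
                    filterᵇ p (concatMap f xs) ≡ concatMap (filterᵇ p ∘ f) xs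
filterᵇ-concatMap p f []       = refl
filterᵇ-concatMap p f (x ∷ xs) = trans (filter-++ (T? ∘ p) (f x) (concatMap f xs))
                                       (cong (filterᵇ p (f x) ++_) (filterᵇ-concatMap p f xs))

cell : Adj n → Fin n → Fin n → List (Edge n)
cell H i j = if does (i <? j) ∧ H i j then (i , j) ∷ [] else []

filterᵇ-cell : (p : Edge n → Bool) (H : Adj n) (i j : Fin n) →
               filterᵇ p (cell H i j) ≡ cell (λ x y → H x y ∧ p (x , y)) i j
filterᵇ-cell p H i j with does (i <? j) | H i j
... | false | _     = refl
... | true  | false = refl
... | true  | true  with p (i , j)
...   | true  = refl
...   | false = refl

filterᵇ-edges : (p : Edge n → Bool) (H : Adj n) →
                filterᵇ p (edges H) ≡ edges (λ x y → H x y ∧ p (x , y))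
filterᵇ-edges {n} p H =
  trans (filterᵇ-concatMap p _ (allFin n))
        (concatMap-cong (λ i → trans (filterᵇ-concatMap p (cell H i) (allFin n))
                                     (concatMap-cong (filterᵇ-cell p H i) (allFin n)))
                        (allFin n))

edges-cong : {H H′ : Adj n} → (∀ x y → H x y ≡ H′ x y) → edges H ≡ edges H′
edges-cong {n} {H} {H′} H≐H′ = concatMap-cong (λ i → concatMap-cong (cell-cong i) (allFin n)) (allFin n)
  where
  cell-cong : ∀ i j → cell H i j ≡ cell H′ i j
  cell-cong i j = cong (λ b → if does (i <? j) ∧ b then (i , j) ∷ [] else []) (H≐H′ i j)

tailAdj : Adj (suc n) → Adj n
tailAdj H x y = H (suc x) (suc y)

liftEdge : Edge n → Edge (suc n)
liftEdge (a , b) = (suc a , suc b)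

cell-suc : (H : Adj (suc n)) (i j : Fin n) →
           cell H (suc i) (suc j) ≡ map liftEdge (cell (tailAdj H) i j)
cell-suc H i j with does (i <? j) ∧ H (suc i) (suc j)
... | true  = refl
... | false = refl

edges-suc : (H : Adj (suc n)) →
            edges H ≡ map (λ j → (zero , suc j)) (filterᵇ (H zero ∘ suc) (allFin n))
                      ++ map liftEdge (edges (tailAdj H))
edges-suc {n} H = begin
  edges H
    ≡⟨ concatMap-allFin-suc row ⟩
  row zero ++ concatMap (row ∘ suc) (allFin n)
    ≡⟨ cong₂ _++_ row-zero (trans (concatMap-cong row-suc (allFin n))
                                  (sym (map-concatMap liftEdge _ (allFin n)))) ⟩
  map (λ j → (zero , suc j)) (filterᵇ (H zero ∘ suc) (allFin n))
    ++ map liftEdge (edges (tailAdj H)) ∎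
  where
  row : Fin (suc n) → List (Edge (suc n))
  row i = concatMap (cell H i) (allFin (suc n))
  row-zero : row zero ≡ map (λ j → (zero , suc j)) (filterᵇ (H zero ∘ suc) (allFin n))
  row-zero = trans (concatMap-allFin-suc (cell H zero)) (concatMap-singletons _ _ (allFin n))
  row-suc : ∀ i → row (suc i) ≡ map liftEdge (concatMap (cell (tailAdj H) i) (allFin n))
  row-suc i = trans (concatMap-allFin-suc (cell H (suc i)))
                    (trans (concatMap-cong (cell-suc H i) (allFin n))
                           (sym (map-concatMap liftEdge _ (allFin n))))

-- Sums over matchings

-- ∑matchings F E φ is the sum of φ (F minus the vertices covered by M) over the matchings
-- M ⊆ E that only use vertices of F.
∑matchings : VertexSet n → List (Edge n) → (VertexSet n → ℕ) → ℕ
∑matchings F []      φ = φ F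
∑matchings F (e ∷ E) φ = ∑matchings F E φ + (if free F e then ∑matchings (F ∖ e) E φ else 0)

#matchings : VertexSet n → List (Edge n) → ℕ
#matchings F E = ∑matchings F E (λ _ → 1)

#matchings[_] : ℕ → VertexSet n → List (Edge n) → ℕ
#matchings[ zero  ] F E       = 1
#matchings[ suc k ] F []      = 0
#matchings[ suc k ] F (e ∷ E) =
  #matchings[ suc k ] F E + (if free F e then #matchings[ k ] (F ∖ e) E else 0)

#matchings[]-∷-blocked : {F : VertexSet n} {e : Edge n} {A : List (Edge n)} → free F e ≡ false →
                         (k : ℕ) → #matchings[ k ] F (e ∷ A) ≡ #matchings[ k ] F A
#matchings[]-∷-blocked Fe zero    = refl
#matchings[]-∷-blocked Fe (suc k) rewrite Fe = +-identityʳ _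

#matchings[]-∷-free : {F : VertexSet n} {e : Edge n} {A : List (Edge n)} → free F e ≡ true →
                      (k : ℕ) → #matchings[ suc k ] F (e ∷ A)
                                ≡ #matchings[ suc k ] F A + #matchings[ k ] (F ∖ e) A
#matchings[]-∷-free Fe k rewrite Fe = refl

-- Vertex sets are functions, so without extensionality a weight has to be shown to
-- respect pointwise equality.
Respects≗ : (VertexSet n → ℕ) → Set
Respects≗ φ = ∀ {F G} → F ≗ G → φ F ≡ φ G

∑matchings-respects : {φ : VertexSet n → ℕ} → Respects≗ φ →
                      (E : List (Edge n)) → Respects≗ (λ F → ∑matchings F E φ)
∑matchings-respects φ-resp []      F≗G = φ-resp F≗G
∑matchings-respects φ-resp (e ∷ E) F≗G =
  cong₂ _+_ (∑matchings-respects φ-resp E F≗G)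
            (cong₂ (λ b x → if b then x else 0) (free-cong F≗G e)
                   (∑matchings-respects φ-resp E (∖-cong F≗G e)))

∑matchings-congʳ : {φ ψ : VertexSet n → ℕ} → (∀ Y → φ Y ≡ ψ Y) →
                   (F : VertexSet n) (E : List (Edge n)) → ∑matchings F E φ ≡ ∑matchings F E ψ
∑matchings-congʳ φ≗ψ F []      = φ≗ψ F
∑matchings-congʳ φ≗ψ F (e ∷ E) = cong₂ (λ x y → x + (if free F e then y else 0))
                                       (∑matchings-congʳ φ≗ψ F E) (∑matchings-congʳ φ≗ψ (F ∖ e) E)

∑matchings-+ : (φ ψ : VertexSet n → ℕ) (F : VertexSet n) (E : List (Edge n)) →
               ∑matchings F E (λ Y → φ Y + ψ Y) ≡ ∑matchings F E φ + ∑matchings F E ψ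
∑matchings-+ φ ψ F []      = refl
∑matchings-+ φ ψ F (e ∷ E) with free F e
... | true  = trans (cong₂ _+_ (∑matchings-+ φ ψ F E) (∑matchings-+ φ ψ (F ∖ e) E))
                    (interchange (∑matchings F E φ) (∑matchings F E ψ) _ _)
... | false = begin
  ∑matchings F E (λ Y → φ Y + ψ Y) + 0
    ≡⟨ +-identityʳ _ ⟩
  ∑matchings F E (λ Y → φ Y + ψ Y)
    ≡⟨ ∑matchings-+ φ ψ F E ⟩
  ∑matchings F E φ + ∑matchings F E ψ
    ≡⟨ cong₂ _+_ (+-identityʳ (∑matchings F E φ)) (+-identityʳ (∑matchings F E ψ)) ⟨
  (∑matchings F E φ + 0) + (∑matchings F E ψ + 0) ∎

∑matchings-++ : (φ : VertexSet n → ℕ) (F : VertexSet n) (A C : List (Edge n)) →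
                ∑matchings F (A ++ C) φ ≡ ∑matchings F A (λ Y → ∑matchings Y C φ)
∑matchings-++ φ F []      C = refl
∑matchings-++ φ F (e ∷ A) C = cong₂ (λ x y → x + (if free F e then y else 0))
                                    (∑matchings-++ φ F A C) (∑matchings-++ φ (F ∖ e) A C)

private
  if-exchange : ∀ {p q r s : Bool} (x y : ℕ) → p ∧ r ≡ q ∧ s →
                (if p then x else 0) + (if q then (if s then y else 0) else 0)
                ≡ (if p then x + (if r then y else 0) else 0)
  if-exchange {true}  {true}  x y refl = refl
  if-exchange {true}  {false} x y refl = refl
  if-exchange {false} {true}  x y refl = refl
  if-exchange {false} {false} x y refl = refl

∑matchings-pull : {χ : VertexSet n → ℕ} → Respects≗ χ →
                  (e : Edge n) (F : VertexSet n) (A : List (Edge n)) →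
                  ∑matchings F A (λ Y → if free Y e then χ (Y ∖ e) else 0)
                  ≡ (if free F e then ∑matchings (F ∖ e) A χ else 0)
∑matchings-pull χ-resp e F []      = refl
∑matchings-pull {χ = χ} χ-resp e F (f ∷ A) = begin
  ∑matchings F A ψ + (if free F f then ∑matchings (F ∖ f) A ψ else 0)
    ≡⟨ cong₂ (λ x y → x + (if free F f then y else 0))
             (∑matchings-pull χ-resp e F A) (∑matchings-pull χ-resp e (F ∖ f) A) ⟩
  (if free F e then ∑matchings (F ∖ e) A χ else 0)
    + (if free F f then (if free (F ∖ f) e then ∑matchings ((F ∖ f) ∖ e) A χ else 0) else 0)
    ≡⟨ cong (λ y → _ + (if free F f then (if free (F ∖ f) e then y else 0) else 0))
            (∑matchings-respects χ-resp A (∖-comm F f e)) ⟩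
  (if free F e then ∑matchings (F ∖ e) A χ else 0)
    + (if free F f then (if free (F ∖ f) e then ∑matchings ((F ∖ e) ∖ f) A χ else 0) else 0)
    ≡⟨ if-exchange {free F e} {free F f} {free (F ∖ e) f} {free (F ∖ f) e} _ _ (free-∖-comm F e f) ⟩
  (if free F e then ∑matchings (F ∖ e) (f ∷ A) χ else 0) ∎
  where
  ψ = λ Y → if free Y e then χ (Y ∖ e) else 0

∑matchings-partition : {φ : VertexSet n → ℕ} → Respects≗ φ →
                       (p : Edge n → Bool) (F : VertexSet n) (E : List (Edge n)) →
                       ∑matchings F E φ
                       ≡ ∑matchings F (filterᵇ p E) (λ Y → ∑matchings Y (filterᵇ (not ∘ p) E) φ)
∑matchings-partition φ-resp p F [] = refl
∑matchings-partition {φ = φ} φ-resp p F (e ∷ E) with p e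
... | true  = cong₂ (λ x y → x + (if free F e then y else 0))
                    (∑matchings-partition φ-resp p F E) (∑matchings-partition φ-resp p (F ∖ e) E)
... | false = begin
  ∑matchings F E φ + (if free F e then ∑matchings (F ∖ e) E φ else 0)
    ≡⟨ cong₂ (λ x y → x + (if free F e then y else 0))
             (∑matchings-partition φ-resp p F E) (∑matchings-partition φ-resp p (F ∖ e) E) ⟩
  ∑matchings F P rest + (if free F e then ∑matchings (F ∖ e) P rest else 0)
    ≡⟨ cong (∑matchings F P rest +_) (∑matchings-pull (∑matchings-respects φ-resp N) e F P) ⟨
  ∑matchings F P rest + ∑matchings F P (λ Y → if free Y e then rest (Y ∖ e) else 0)
    ≡⟨ ∑matchings-+ rest _ F P ⟨
  ∑matchings F P (λ Y → ∑matchings Y (e ∷ N) φ) ∎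
  where
  P = filterᵇ p E
  N = filterᵇ (not ∘ p) E
  rest = λ Y → ∑matchings Y N φ

∑matchings-lift : (ψ : VertexSet n → ℕ) (F : VertexSet (suc n)) (E : List (Edge n)) →
                  ∑matchings F (map liftEdge E) (ψ ∘ (_∘ suc)) ≡ ∑matchings (F ∘ suc) E ψ
∑matchings-lift ψ F []      = refl
∑matchings-lift ψ F (e ∷ E) = cong₂ (λ x y → x + (if free F (liftEdge e) then y else 0))
                                    (∑matchings-lift ψ F E) (∑matchings-lift ψ (F ∖ liftEdge e) E)

∑matchings-blocked : (a : Fin n) (f : A → Fin n) (φ : VertexSet n → ℕ) (Y : VertexSet n) →
                     Y a ≡ false → (xs : List A) → ∑matchings Y (map (λ x → (a , f x)) xs) φ ≡ φ Y
∑matchings-blocked a f φ Y Ya≡false []       = refl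
∑matchings-blocked a f φ Y Ya≡false (x ∷ xs) rewrite Ya≡false =
  trans (+-identityʳ _) (∑matchings-blocked a f φ Y Ya≡false xs)

∑matchings-star : (a : Fin n) (f : A → Fin n) (φ : VertexSet n → ℕ) (F : VertexSet n) (xs : List A) →
                  ∑matchings F (map (λ x → (a , f x)) xs) φ
                  ≡ φ F + sum (map (λ x → if free F (a , f x) then φ (F ∖ (a , f x)) else 0) xs)
∑matchings-star a f φ F []       = sym (+-identityʳ (φ F))
∑matchings-star a f φ F (x ∷ xs) = begin
  ∑matchings F star φ + (if free F e then ∑matchings (F ∖ e) star φ else 0)
    ≡⟨ cong₂ (λ s t → s + (if free F e then t else 0))
             (∑matchings-star a f φ F xs) (∑matchings-blocked a f φ (F ∖ e) a∉F∖e xs) ⟩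
  (φ F + S) + (if free F e then φ (F ∖ e) else 0)
    ≡⟨ +-assoc (φ F) S _ ⟩
  φ F + (S + (if free F e then φ (F ∖ e) else 0))
    ≡⟨ cong (φ F +_) (+-comm S _) ⟩
  φ F + ((if free F e then φ (F ∖ e) else 0) + S) ∎
  where
  e = (a , f x)
  star = map (λ x → (a , f x)) xs
  S = sum (map (λ x → if free F (a , f x) then φ (F ∖ (a , f x)) else 0) xs)
  a∉F∖e : (F ∖ e) a ≡ false
  a∉F∖e rewrite dec-true (a ≟ a) refl = ∧-zeroʳ (F a)

#matchings-suc : (H : Adj (suc n)) (F : VertexSet (suc n)) →
                 #matchings F (edges H)
                 ≡ #matchings (F ∘ suc) (edges (tailAdj H))
                   + sum (map (λ j → if free F (zero , suc j)
                                       then #matchings ((F ∖ (zero , suc j)) ∘ suc) (edges (tailAdj H))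
                                       else 0)
                              (filterᵇ (H zero ∘ suc) (allFin n)))
#matchings-suc {n} H F = begin
  #matchings F (edges H)
    ≡⟨ cong (#matchings F) (edges-suc H) ⟩
  #matchings F (star ++ map liftEdge (edges (tailAdj H)))
    ≡⟨ ∑matchings-++ _ F star (map liftEdge (edges (tailAdj H))) ⟩
  ∑matchings F star (λ Y → #matchings Y (map liftEdge (edges (tailAdj H))))
    ≡⟨ ∑matchings-congʳ (λ Y → ∑matchings-lift _ Y (edges (tailAdj H))) F star ⟩
  ∑matchings F star (λ Y → #matchings (Y ∘ suc) (edges (tailAdj H)))
    ≡⟨ ∑matchings-star zero suc _ F (filterᵇ (H zero ∘ suc) (allFin n)) ⟩
  _ ∎
  where
  star = map (λ j → (zero , suc j)) (filterᵇ (H zero ∘ suc) (allFin n))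

count : (A → Bool) → List A → ℕ
count p []       = 0
count p (x ∷ xs) = if p x then suc (count p xs) else count p xs

module _ {ℓ} {P : Pred A ℓ} (P? : Decidable P) where

  length-filter : (xs : List A) → length (filter P? xs) ≡ count (does ∘ P?) xs
  length-filter []       = refl
  length-filter (x ∷ xs) with does (P? x)
  ... | true  = cong suc (length-filter xs)
  ... | false = length-filter xs

  count-filter : (q : A → Bool) (xs : List A) →
                 count q (filter P? xs) ≡ count (λ x → does (P? x) ∧ q x) xs
  count-filter q []       = refl
  count-filter q (x ∷ xs) with does (P? x)
  ... | true  = cong (λ c → if q x then suc c else c) (count-filter q xs)
  ... | false = count-filter q xs

count-cong : {p q : A → Bool} → p ≗ q → (xs : List A) → count p xs ≡ count q xs
count-cong p≗q []       = refl
count-cong p≗q (x ∷ xs) = cong₂ (λ b c → if b then suc c else c) (p≗q x) (count-cong p≗q xs)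

count-++ : (p : A → Bool) (xs ys : List A) → count p (xs ++ ys) ≡ count p xs + count p ys
count-++ p []       ys = refl
count-++ p (x ∷ xs) ys with p x
... | true  = cong suc (count-++ p xs ys)
... | false = count-++ p xs ys

count-map : (p : C → Bool) (f : A → C) (xs : List A) → count p (map f xs) ≡ count (p ∘ f) xs
count-map p f []       = refl
count-map p f (x ∷ xs) = cong (λ c → if p (f x) then suc c else c) (count-map p f xs)

count-false : (xs : List A) → count (λ _ → false) xs ≡ 0
count-false []       = refl
count-false (x ∷ xs) = count-false xs

count-∧ˡ : (b : Bool) (q : A → Bool) (xs : List A) →
           count (λ x → b ∧ q x) xs ≡ (if b then count q xs else 0)
count-∧ˡ true  q xs = refl
count-∧ˡ false q xs = count-false xs

count-subsets-∷ : (p : List A → Bool) (x : A) (xs : List A) →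
                  count p (subsets (x ∷ xs)) ≡ count p (subsets xs) + count (p ∘ (x ∷_)) (subsets xs)
count-subsets-∷ p x xs = trans (count-++ p (subsets xs) _)
                               (cong (count p (subsets xs) +_) (count-map p (x ∷_) (subsets xs)))

does-≟-true : (b : Bool) → does (b ≟ᵇ true) ≡ b
does-≟-true true  = refl
does-≟-true false = refl

isMatchingIn : VertexSet n → List (Edge n) → Bool
isMatchingIn F S = isMatching S ∧ allL (free F) S

allL-disjointEdge-free : (F : VertexSet n) (e : Edge n) (S : List (Edge n)) →
                         allL (disjointEdge e) S ∧ allL (free F) S ≡ allL (free (F ∖ e)) S
allL-disjointEdge-free F e []      = refl
allL-disjointEdge-free F e (f ∷ S) =
  trans (solve 4 (λ d D p P → (d ⊕ D) ⊕ (p ⊕ P) ⊜ (d ⊕ p) ⊕ (D ⊕ P)) refl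
                 (disjointEdge e f) (allL (disjointEdge e) S) (free F f) (allL (free F) S))
        (cong₂ _∧_ (disjointEdge-free F e f) (allL-disjointEdge-free F e S))

isMatchingIn-∷ : (F : VertexSet n) (e : Edge n) (S : List (Edge n)) →
                 isMatchingIn F (e ∷ S) ≡ free F e ∧ isMatchingIn (F ∖ e) S
isMatchingIn-∷ F e S =
  trans (solve 4 (λ d M f P → (d ⊕ M) ⊕ (f ⊕ P) ⊜ f ⊕ (M ⊕ (d ⊕ P))) refl
                 (allL (disjointEdge e) S) (isMatching S) (free F e) (allL (free F) S))
        (cong (λ x → free F e ∧ (isMatching S ∧ x)) (allL-disjointEdge-free F e S))

isMatchingIn-univ : (S : List (Edge n)) → isMatchingIn univ S ≡ isMatching S
isMatchingIn-univ S = trans (cong (isMatching S ∧_) (all-free S)) (∧-identityʳ (isMatching S))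
  where
  all-free : (S : List (Edge n)) → allL (free univ) S ≡ true
  all-free []      = refl
  all-free (_ ∷ S) = all-free S

count-matchings : (F : VertexSet n) (E : List (Edge n)) →
                  count (isMatchingIn F) (subsets E) ≡ #matchings F E
count-matchings F []      = refl
count-matchings F (e ∷ E) = begin
  count (isMatchingIn F) (subsets (e ∷ E))
    ≡⟨ count-subsets-∷ (isMatchingIn F) e E ⟩
  count (isMatchingIn F) (subsets E) + count (isMatchingIn F ∘ (e ∷_)) (subsets E)
    ≡⟨ cong₂ _+_ (count-matchings F E) (count-cong (isMatchingIn-∷ F e) (subsets E)) ⟩
  #matchings F E + count (λ S → free F e ∧ isMatchingIn (F ∖ e) S) (subsets E)
    ≡⟨ cong (#matchings F E +_) (count-∧ˡ (free F e) (isMatchingIn (F ∖ e)) (subsets E)) ⟩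
  #matchings F E + (if free F e then count (isMatchingIn (F ∖ e)) (subsets E) else 0)
    ≡⟨ cong (λ c → #matchings F E + (if free F e then c else 0)) (count-matchings (F ∖ e) E) ⟩
  #matchings F (e ∷ E) ∎

count-matchings-of-size : (k : ℕ) (F : VertexSet n) (E : List (Edge n)) →
                          count (λ S → isMatchingIn F S ∧ does (length S ℕ.≟ k)) (subsets E)
                          ≡ #matchings[ k ] F E
count-matchings-of-size zero    F []      = refl
count-matchings-of-size (suc k) F []      = refl
count-matchings-of-size zero    F (e ∷ E) = begin
  count (sized 0) (subsets (e ∷ E))
    ≡⟨ count-subsets-∷ (sized 0) e E ⟩
  count (sized 0) (subsets E) + count (λ S → isMatchingIn F (e ∷ S) ∧ false) (subsets E)
    ≡⟨ cong₂ _+_ (count-matchings-of-size 0 F E) (count-cong (λ _ → ∧-zeroʳ _) (subsets E)) ⟩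
  1 + count (λ _ → false) (subsets E)
    ≡⟨ cong suc (count-false (subsets E)) ⟩
  1 ∎
  where
  sized = λ k S → isMatchingIn F S ∧ does (length S ℕ.≟ k)
count-matchings-of-size (suc k) F (e ∷ E) = begin
  count (sized F (suc k)) (subsets (e ∷ E))
    ≡⟨ count-subsets-∷ (sized F (suc k)) e E ⟩
  count (sized F (suc k)) (subsets E) + count (sized F (suc k) ∘ (e ∷_)) (subsets E)
    ≡⟨ cong₂ _+_ (count-matchings-of-size (suc k) F E) (count-cong reassoc (subsets E)) ⟩
  #matchings[ suc k ] F E + count (λ S → free F e ∧ sized (F ∖ e) k S) (subsets E)
    ≡⟨ cong (#matchings[ suc k ] F E +_) (count-∧ˡ (free F e) (sized (F ∖ e) k) (subsets E)) ⟩
  #matchings[ suc k ] F E + (if free F e then count (sized (F ∖ e) k) (subsets E) else 0)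
    ≡⟨ cong (λ c → #matchings[ suc k ] F E + (if free F e then c else 0))
            (count-matchings-of-size k (F ∖ e) E) ⟩
  #matchings[ suc k ] F (e ∷ E) ∎
  where
  sized = λ F k S → isMatchingIn F S ∧ does (length S ℕ.≟ k)
  reassoc : ∀ S → sized F (suc k) (e ∷ S) ≡ free F e ∧ sized (F ∖ e) k S
  reassoc S = trans (cong (_∧ _) (isMatchingIn-∷ F e S)) (∧-assoc (free F e) _ _)

m≡#matchings : (G : Adj n) → m G ≡ #matchings univ (edges G)
m≡#matchings G = begin
  length (filter (λ S → isMatching S ≟ᵇ true) (subsets (edges G)))
    ≡⟨ length-filter (λ S → isMatching S ≟ᵇ true) (subsets (edges G)) ⟩
  count (λ S → does (isMatching S ≟ᵇ true)) (subsets (edges G))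
    ≡⟨ count-cong (λ S → trans (does-≟-true (isMatching S)) (sym (isMatchingIn-univ S)))
                  (subsets (edges G)) ⟩
  count (isMatchingIn univ) (subsets (edges G))
    ≡⟨ count-matchings univ (edges G) ⟩
  #matchings univ (edges G) ∎

mk≡#matchings[] : (k : ℕ) (G : Adj n) → mk k G ≡ #matchings[ k ] univ (edges G)
mk≡#matchings[] k G = begin
  length (filter (λ S → length S ℕ.≟ k) (matchings G))
    ≡⟨ length-filter (λ S → length S ℕ.≟ k) (matchings G) ⟩
  count (λ S → does (length S ℕ.≟ k)) (filter (λ S → isMatching S ≟ᵇ true) (subsets (edges G)))
    ≡⟨ count-filter (λ S → isMatching S ≟ᵇ true) _ (subsets (edges G)) ⟩
  count (λ S → does (isMatching S ≟ᵇ true) ∧ sized S) (subsets (edges G))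
    ≡⟨ count-cong (λ S → cong (_∧ sized S) (trans (does-≟-true (isMatching S))
                                                   (sym (isMatchingIn-univ S))))
                  (subsets (edges G)) ⟩
  count (λ S → isMatchingIn univ S ∧ sized S) (subsets (edges G))
    ≡⟨ count-matchings-of-size k univ (edges G) ⟩
  #matchings[ k ] univ (edges G) ∎
  where
  sized = λ (S : List (Edge _)) → does (length S ℕ.≟ k)

card≡count : (P : VertexSet n) → card P ≡ count P (allFin n)
card≡count {n} P = trans (length-filter (λ x → P x ≟ᵇ true) (allFin n))
                         (count-cong (does-≟-true ∘ P) (allFin n))

card-cong : {P Q : VertexSet n} → P ≗ Q → card P ≡ card Q
card-cong {n} {P} {Q} P≗Q =
  trans (card≡count P) (trans (count-cong P≗Q (allFin n)) (sym (card≡count Q)))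

card-suc : (P : VertexSet (suc n)) →
           card P ≡ (if P zero then suc (card (P ∘ suc)) else card (P ∘ suc))
card-suc {n} P = trans (card≡count P) (cong (λ c → if P zero then suc c else c) count-tail)
  where
  count-tail : count P (tabulate suc) ≡ card (P ∘ suc)
  count-tail = trans (cong (count P) (sym (map-tabulate id suc)))
                     (trans (count-map P suc (allFin n)) (sym (card≡count (P ∘ suc))))

card-univ : card {n} univ ≡ n
card-univ {zero}  = refl
card-univ {suc n} = trans (card-suc (univ {suc n})) (cong suc (card-univ {n}))

card-remove : (P : VertexSet n) (u : Fin n) → P u ≡ true →
              card P ≡ suc (card (λ v → P v ∧ u ≢ᵇ v))
card-remove P zero Pu
  rewrite card-suc P | card-suc (λ v → P v ∧ zero ≢ᵇ v) | Pu =
  cong suc (card-cong (λ v → sym (∧-identityʳ (P (suc v)))))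
card-remove P (suc u) Pu
  rewrite card-suc P | card-suc (λ v → P v ∧ suc u ≢ᵇ v) | ∧-identityʳ (P zero)
        | card-remove (P ∘ suc) u Pu
  with P zero
... | true  = refl
... | false = refl

-- Matchings of a clique

sum-filterᵇ-if : (q p : A → Bool) (g : A → ℕ) (v : ℕ) →
                 (∀ x → q x ≡ true → p x ≡ true → g x ≡ v) → (xs : List A) →
                 sum (map (λ x → if p x then g x else 0) (filterᵇ q xs))
                 ≡ count (λ x → q x ∧ p x) xs * v
sum-filterᵇ-if q p g v g≡v []       = refl
sum-filterᵇ-if q p g v g≡v (x ∷ xs) with q x in qx
... | false = sum-filterᵇ-if q p g v g≡v xs
... | true  with p x in px
...   | true  = cong₂ _+_ (g≡v x qx px) (sum-filterᵇ-if q p g v g≡v xs)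
...   | false = sum-filterᵇ-if q p g v g≡v xs

telephone : ℕ → ℕ
telephone zero          = 1
telephone (suc zero)    = 1
telephone (suc (suc c)) = telephone (suc c) + suc c * telephone c

telephone-suc : (c : ℕ) → telephone (suc c) ≡ telephone c + c * telephone (c ∸ 1)
telephone-suc zero    = refl
telephone-suc (suc c) = refl

cliqueOn : VertexSet n → Adj n
cliqueOn W x y = x ≢ᵇ y ∧ (W x ∧ W y)

#matchings-cliqueOn : (W F : VertexSet n) → #matchings F (edges (cliqueOn W)) ≡ telephone (card (W ∩ F))
#matchings-cliqueOn {zero}  W F = refl
#matchings-cliqueOn {suc n} W F = begin
  #matchings F (edges (cliqueOn W))
    ≡⟨ #matchings-suc (cliqueOn W) F ⟩
  #matchings F′ (edges (cliqueOn W′))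
    + sum (map (λ j → if-free j (#matchings (F′-without j) (edges (cliqueOn W′)))) neighbours)
    ≡⟨ cong₂ _+_ (#matchings-cliqueOn W′ F′)
                 (cong sum (map-cong (λ j → cong (if-free j) (#matchings-cliqueOn W′ (F′-without j)))
                                     neighbours)) ⟩
  telephone c′ + sum (map (λ j → if-free j (telephone (card (W′ ∩ F′-without j)))) neighbours)
    ≡⟨ cong (telephone c′ +_) (sum-filterᵇ-if _ _ _ (telephone (c′ ∸ 1)) one-fewer (allFin n)) ⟩
  telephone c′ + count (λ j → (W zero ∧ W (suc j)) ∧ (F zero ∧ F (suc j))) (allFin n)
                 * telephone (c′ ∸ 1)
    ≡⟨ cong (λ c → telephone c′ + c * telephone (c′ ∸ 1)) free-neighbours ⟩
  telephone c′ + (if W zero ∧ F zero then c′ else 0) * telephone (c′ ∸ 1)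
    ≡⟨ recurrence (W zero ∧ F zero) ⟩
  telephone (if W zero ∧ F zero then suc c′ else c′)
    ≡⟨ cong telephone (card-suc (W ∩ F)) ⟨
  telephone (card (W ∩ F)) ∎
  where
  W′ F′ : VertexSet n
  W′ = W ∘ suc
  F′ = F ∘ suc
  F′-without : Fin n → VertexSet n
  F′-without j i = F′ i ∧ j ≢ᵇ i
  c′ = card (W′ ∩ F′)
  neighbours = filterᵇ (λ j → W zero ∧ W (suc j)) (allFin n)
  if-free : Fin n → ℕ → ℕ
  if-free j x = if F zero ∧ F (suc j) then x else 0
  one-fewer : ∀ j → W zero ∧ W (suc j) ≡ true → F zero ∧ F (suc j) ≡ true →
              telephone (card (W′ ∩ F′-without j)) ≡ telephone (c′ ∸ 1)
  one-fewer j Wj Fj = cong telephone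
    (trans (card-cong (λ i → sym (∧-assoc (W′ i) (F′ i) (j ≢ᵇ i))))
           (cong (_∸ 1) (sym (card-remove (W′ ∩ F′) j (cong₂ _∧_ (∧-trueʳ (W zero) Wj)
                                                                 (∧-trueʳ (F zero) Fj))))))
  free-neighbours : count (λ j → (W zero ∧ W (suc j)) ∧ (F zero ∧ F (suc j))) (allFin n)
                    ≡ (if W zero ∧ F zero then c′ else 0)
  free-neighbours = begin
    count (λ j → (W zero ∧ W (suc j)) ∧ (F zero ∧ F (suc j))) (allFin n)
      ≡⟨ count-cong (λ j → solve 4 (λ a b c d → (a ⊕ b) ⊕ (c ⊕ d) ⊜ (a ⊕ c) ⊕ (b ⊕ d)) refl
                                   (W zero) (W (suc j)) (F zero) (F (suc j))) (allFin n) ⟩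
    count (λ j → (W zero ∧ F zero) ∧ (W′ ∩ F′) j) (allFin n)
      ≡⟨ count-∧ˡ (W zero ∧ F zero) (W′ ∩ F′) (allFin n) ⟩
    (if W zero ∧ F zero then count (W′ ∩ F′) (allFin n) else 0)
      ≡⟨ cong (λ c → if W zero ∧ F zero then c else 0) (card≡count (W′ ∩ F′)) ⟨
    (if W zero ∧ F zero then c′ else 0) ∎
  recurrence : ∀ b → telephone c′ + (if b then c′ else 0) * telephone (c′ ∸ 1)
                     ≡ telephone (if b then suc c′ else c′)
  recurrence true  = sym (telephone-suc c′)
  recurrence false = +-identityʳ (telephone c′)

m-complete : (j : ℕ) → m (complete j) ≡ telephone j
m-complete j = begin
  m (complete j)                     ≡⟨ m≡#matchings (complete j) ⟩
  #matchings U (edges (complete j))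
    ≡⟨ cong (#matchings U) (edges-cong (λ x y → sym (∧-identityʳ (x ≢ᵇ y)))) ⟩
  #matchings U (edges (cliqueOn U))  ≡⟨ #matchings-cliqueOn U U ⟩
  telephone (card U)                 ≡⟨ cong telephone (card-univ {j}) ⟩
  telephone j                        ∎
  where
  U = univ {j}

sum-map-+ : (f g : A → ℕ) (xs : List A) →
            sum (map (λ x → f x + g x) xs) ≡ sum (map f xs) + sum (map g xs)
sum-map-+ f g []       = refl
sum-map-+ f g (x ∷ xs) = trans (cong (f x + g x +_) (sum-map-+ f g xs)) (interchange (f x) (g x) _ _)

sumUpTo-cong : (s : ℕ) {f g : ℕ → ℕ} → (∀ k → f k ≡ g k) → sumUpTo s f ≡ sumUpTo s g
sumUpTo-cong s f≗g = cong sum (map-cong f≗g (upTo (suc s)))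

sumUpTo-+ : (s : ℕ) (f g : ℕ → ℕ) → sumUpTo s (λ k → f k + g k) ≡ sumUpTo s f + sumUpTo s g
sumUpTo-+ s f g = sum-map-+ f g (upTo (suc s))

sumUpTo-suc : (s : ℕ) (f : ℕ → ℕ) → sumUpTo (suc s) f ≡ f 0 + sumUpTo s (f ∘ suc)
sumUpTo-suc s f = cong (λ xs → f 0 + sum xs)
  (trans (map-applyUpTo suc f (suc s)) (sym (map-applyUpTo id (f ∘ suc) (suc s))))

sumUpTo-head : (s : ℕ) (f : ℕ → ℕ) → (∀ k → f (suc k) ≡ 0) → sumUpTo s f ≡ f 0
sumUpTo-head zero    f tail≡0 = +-identityʳ (f 0)
sumUpTo-head (suc s) f tail≡0 = begin
  sumUpTo (suc s) f          ≡⟨ sumUpTo-suc s f ⟩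
  f 0 + sumUpTo s (f ∘ suc)  ≡⟨ cong (f 0 +_) (sumUpTo-head s (f ∘ suc) (tail≡0 ∘ suc)) ⟩
  f 0 + f 1                  ≡⟨ cong (f 0 +_) (tail≡0 0) ⟩
  f 0 + 0                    ≡⟨ +-identityʳ (f 0) ⟩
  f 0                        ∎

sumUpTo-shift : (s : ℕ) (a b c x : ℕ → ℕ) → c 0 ≡ a 0 → (∀ k → c (suc k) ≡ a (suc k) + b k) →
                sumUpTo (suc s) (λ k → a k * x k) + sumUpTo s (λ k → b k * x (suc k))
                ≡ sumUpTo (suc s) (λ k → c k * x k)
sumUpTo-shift s a b c x c₀ c-suc = begin
  sumUpTo (suc s) (λ k → a k * x k) + sumUpTo s (λ k → b k * x (suc k))
    ≡⟨ cong (_+ sumUpTo s (λ k → b k * x (suc k))) (sumUpTo-suc s (λ k → a k * x k)) ⟩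
  (a 0 * x 0 + sumUpTo s (λ k → a (suc k) * x (suc k))) + sumUpTo s (λ k → b k * x (suc k))
    ≡⟨ +-assoc (a 0 * x 0) _ _ ⟩
  a 0 * x 0 + (sumUpTo s (λ k → a (suc k) * x (suc k)) + sumUpTo s (λ k → b k * x (suc k)))
    ≡⟨ cong₂ _+_ (cong (_* x 0) (sym c₀))
                 (sym (sumUpTo-+ s (λ k → a (suc k) * x (suc k)) (λ k → b k * x (suc k)))) ⟩
  c 0 * x 0 + sumUpTo s (λ k → a (suc k) * x (suc k) + b k * x (suc k))
    ≡⟨ cong (c 0 * x 0 +_) (sumUpTo-cong s λ k →
         trans (sym (*-distribʳ-+ (x (suc k)) (a (suc k)) (b k))) (cong (_* x (suc k)) (sym (c-suc k)))) ⟩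
  c 0 * x 0 + sumUpTo s (λ k → c (suc k) * x (suc k))
    ≡⟨ sumUpTo-suc s (λ k → c k * x k) ⟨
  sumUpTo (suc s) (λ k → c k * x k) ∎

-- Matchings of crossing edges

crossing : VertexSet n → Edge n → Bool
crossing K (a , b) = K a xor K b

card-∩-∖ : (K F : VertexSet n) (a b : Fin n) → K a ≡ true → K b ≡ false → F a ≡ true →
           card (K ∩ F) ≡ suc (card (K ∩ (F ∖ (a , b))))
card-∩-∖ K F a b Ka Kb Fa =
  trans (card-remove (K ∩ F) a (cong₂ _∧_ Ka Fa)) (cong suc (card-cong drop-b))
  where
  drop-b : ∀ v → (K v ∧ F v) ∧ a ≢ᵇ v ≡ K v ∧ (F v ∧ (a ≢ᵇ v ∧ b ≢ᵇ v))
  drop-b v with b ≟ v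
  ... | yes refl rewrite Kb = refl
  ... | no _     = trans (∧-assoc (K v) (F v) (a ≢ᵇ v))
                         (cong (λ x → K v ∧ (F v ∧ x)) (sym (∧-identityʳ (a ≢ᵇ v))))

card-∩-∖-crossing : (K F : VertexSet n) (e : Edge n) → free F e ≡ true → T (crossing K e) →
                    card (K ∩ F) ≡ suc (card (K ∩ (F ∖ e)))
card-∩-∖-crossing K F (a , b) Fe cr with K a in Ka | K b in Kb
card-∩-∖-crossing K F (a , b) Fe cr | true  | false = card-∩-∖ K F a b Ka Kb (∧-trueˡ (F a) Fe)
card-∩-∖-crossing K F (a , b) Fe cr | false | true  =
  trans (card-∩-∖ K F b a Kb Ka (∧-trueʳ (F a) Fe))
        (cong suc (card-cong (λ v → cong (K v ∧_) (∖-swap F b a v))))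
card-∩-∖-crossing K F (a , b) Fe () | true  | true
card-∩-∖-crossing K F (a , b) Fe () | false | false

-- Each crossing edge of a matching covers exactly one vertex of K, so a k-edge matching
-- leaves card (K ∩ F) ∸ k vertices of K uncovered.
∑matchings-crossing : (K : VertexSet n) (h : ℕ → ℕ) (F : VertexSet n) (A : List (Edge n)) →
                      All (T ∘ crossing K) A →
                      ∑matchings F A (λ Y → h (card (K ∩ Y)))
                      ≡ sumUpTo (card (K ∩ F)) (λ k → #matchings[ k ] F A * h (card (K ∩ F) ∸ k))
∑matchings-crossing K h F [] [] =
  sym (trans (sumUpTo-head (card (K ∩ F)) _ (λ _ → refl)) (*-identityˡ (h (card (K ∩ F)))))
∑matchings-crossing K h F (e ∷ A) (cr ∷ crs) with free F e in Fe
... | false = trans (+-identityʳ _)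
                (trans (∑matchings-crossing K h F A crs)
                       (sumUpTo-cong (card (K ∩ F))
                                     (λ k → cong (_* _) (sym (#matchings[]-∷-blocked Fe k)))))
... | true  = trans (cong₂ _+_ (∑matchings-crossing K h F A crs)
                               (∑matchings-crossing K h (F ∖ e) A crs))
                    (combine (card-∩-∖-crossing K F e Fe cr))
  where
  combine : ∀ {c c′} → c ≡ suc c′ →
            sumUpTo c (λ k → #matchings[ k ] F A * h (c ∸ k))
              + sumUpTo c′ (λ k → #matchings[ k ] (F ∖ e) A * h (c′ ∸ k))
            ≡ sumUpTo c (λ k → #matchings[ k ] F (e ∷ A) * h (c ∸ k))
  combine {c′ = c′} refl =
    sumUpTo-shift c′ (λ k → #matchings[ k ] F A) (λ k → #matchings[ k ] (F ∖ e) A)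
                  (λ k → #matchings[ k ] F (e ∷ A)) (λ k → h (suc c′ ∸ k))
                  refl (#matchings[]-∷-free Fe)

nonCrossing≐cliqueOn : (G : Adj n) (K : VertexSet n) → (∀ x → G x x ≡ false) → IsClique G K →
                       IsIndependent G (λ x → not (K x)) →
                       ∀ x y → G x y ∧ not (crossing K (x , y)) ≡ cliqueOn K x y
nonCrossing≐cliqueOn G K irreflexive clique independent x y with x ≟ y
... | yes refl rewrite irreflexive x = refl
... | no x≢y with K x in Kx | K y in Ky
...   | true  | true  rewrite clique x y Kx Ky x≢y = refl
...   | true  | false = ∧-zeroʳ (G x y)
...   | false | true  = ∧-zeroʳ (G x y)
...   | false | false rewrite independent x y (cong not Kx) (cong not Ky) = refl

lemma3p1 : ∀ {n : ℕ} (G : Adj n) (K : Fin n → Bool) → IsSimple G → IsThreshold G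
           → IsClique G K → IsIndependent G (λ x → not (K x))
           → m G ≡ sumUpTo (card K) (λ k → mk k (between G K) * m (complete (card K ∸ k)))
lemma3p1 G K (_ , irreflexive) _ clique independent = begin
  m G
    ≡⟨ m≡#matchings G ⟩
  #matchings univ (edges G)
    ≡⟨ ∑matchings-partition (λ _ → refl) (crossing K) univ (edges G) ⟩
  ∑matchings univ (filterᵇ (crossing K) (edges G))
                  (λ Y → #matchings Y (filterᵇ (not ∘ crossing K) (edges G)))
    ≡⟨ cong₂ (λ A C → ∑matchings univ A (λ Y → #matchings Y C))
             (filterᵇ-edges (crossing K) G) inside-K ⟩
  ∑matchings univ (edges B) (λ Y → #matchings Y (edges (cliqueOn K)))
    ≡⟨ ∑matchings-congʳ (λ Y → trans (#matchings-cliqueOn K Y) (sym (m-complete (card (K ∩ Y)))))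
                        univ (edges B) ⟩
  ∑matchings univ (edges B) (λ Y → m (complete (card (K ∩ Y))))
    ≡⟨ ∑matchings-crossing K (m ∘ complete) univ (edges B) B-crossing ⟩
  sumUpTo (card (K ∩ univ))
          (λ k → #matchings[ k ] univ (edges B) * m (complete (card (K ∩ univ) ∸ k)))
    ≡⟨ cong (λ s → sumUpTo s (λ k → #matchings[ k ] univ (edges B) * m (complete (s ∸ k))))
            (card-cong (∧-identityʳ ∘ K)) ⟩
  sumUpTo (card K) (λ k → #matchings[ k ] univ (edges B) * m (complete (card K ∸ k)))
    ≡⟨ sumUpTo-cong (card K) (λ k → cong (_* m (complete (card K ∸ k))) (mk≡#matchings[] k B)) ⟨
  sumUpTo (card K) (λ k → mk k B * m (complete (card K ∸ k))) ∎
  where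
  B = between G K
  inside-K : filterᵇ (not ∘ crossing K) (edges G) ≡ edges (cliqueOn K)
  inside-K = trans (filterᵇ-edges (not ∘ crossing K) G)
                   (edges-cong (nonCrossing≐cliqueOn G K irreflexive clique independent))
  B-crossing : All (T ∘ crossing K) (edges B)
  B-crossing = subst (All (T ∘ crossing K)) (filterᵇ-edges (crossing K) G)
                     (all-filter (T? ∘ crossing K) (edges G))
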